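{- For all formulas $\varphi,\psi$ of the logic $\mathbf{L}$, the following are provable in $\mathbf{L}$: (1a) $\varphi\sqcap\varphi\Rightarrow\varphi\sqcap(\varphi\vee\psi)$; (1b) $\varphi\sqcup(\varphi\wedge\psi)\Rightarrow\varphi\sqcup\varphi$; (2a) $\bot\Rightarrow\varphi$; (2b) $\varphi\Rightarrow\top$; (3a) $\neg\top\Rightarrow\bot$; (3b) $\top\Rightarrow\lrcorner\bot$; (4a) $\neg\bot\Leftrightarrow\top\sqcap\top$; (4b) $\lrcorner\top\Leftrightarrow\bot\sqcup\bot$.
   Context: Formulas of $\mathbf{L}$ are built from a countable set of propositional variables and constants $\top,\bot$ by $\varphi::=p\mid\neg\varphi\mid\lrcorner\varphi\mid\varphi\sqcap\varphi\mid\varphi\sqcup\varphi\mid\top\mid\bot$; abbreviate $\varphi\vee\psi:=\neg(\neg\varphi\sqcap\neg\psi)$ and $\varphi\wedge\psi:=\lrcorner(\lrcorner\varphi\sqcup\lrcorner\psi)$. Sequents have the form $\varphi\Rightarrow\psi$; $\varphi\Leftrightarrow\psi$ stands for the two sequents $\varphi\Rightarrow\psi$ and $\psi\Rightarrow\varphi$. Axioms of $\mathbf{L}$ (for all formulas $\varphi,\psi,\theta$): $\varphi\Rightarrow\varphi$; $\varphi\sqcap\psi\Rightarrow\varphi$; $\varphi\sqcap\psi\Rightarrow\psi$; $\varphi\Rightarrow\varphi\sqcup\psi$; $\psi\Rightarrow\varphi\sqcup\psi$; $\neg(\varphi\sqcap\varphi)\Rightarrow\neg\varphi$; $\lrcorner\varphi\Rightarrow\lrcorner(\varphi\sqcup\varphi)$;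 $\varphi\sqcap\neg\varphi\Leftrightarrow\bot$; $\top\Leftrightarrow\varphi\sqcup\lrcorner\varphi$; $\neg\neg(\varphi\sqcap\psi)\Leftrightarrow\varphi\sqcap\psi$; $\lrcorner\lrcorner(\varphi\sqcup\psi)\Leftrightarrow\varphi\sqcup\psi$; $\varphi\sqcap\varphi\Rightarrow\varphi\sqcap(\varphi\sqcup\psi)$; $\varphi\sqcup(\varphi\sqcap\psi)\Rightarrow\varphi\sqcup\varphi$; $\varphi\sqcap(\psi\vee\theta)\Leftrightarrow(\varphi\sqcap\psi)\vee(\varphi\sqcap\theta)$; $\varphi\sqcup(\psi\wedge\theta)\Leftrightarrow(\varphi\sqcup\psi)\wedge(\varphi\sqcup\theta)$; $(\varphi\sqcup\varphi)\sqcap(\varphi\sqcup\varphi)\Leftrightarrow(\varphi\sqcap\varphi)\sqcup(\varphi\sqcap\varphi)$. Rules: (Cut) from $\varphi\Rightarrow\psi$ and $\psi\Rightarrow\theta$ infer $\varphi\Rightarrow\theta$; from $\varphi\Rightarrow\psi$ infer each of $\varphi\sqcap\theta\Rightarrow\psi\sqcap\theta$, $\theta\sqcap\varphi\Rightarrow\theta\sqcap\psi$, $\varphi\sqcup\theta\Rightarrow\psi\sqcup\theta$, $\theta\sqcup\varphi\Rightarrow\theta\sqcup\psi$, $\neg\psi\Rightarrow\neg\varphi$, $\lrcorner\psi\Rightarrow\lrcorner\varphi$; ($\sqsubseteq$) from the four sequents $\varphi\sqcap\psi\Rightarrow\varphi\sqcap\varphi$, $\varphi\sqcap\varphi\Rightarrow\varphi\sqcap\psi$,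 $\varphi\sqcup\psi\Rightarrow\psi\sqcup\psi$, $\psi\sqcup\psi\Rightarrow\varphi\sqcup\psi$ infer $\varphi\Rightarrow\psi$. A sequent is provable if it is the last element of a finite sequence of sequents each of which is an axiom or follows from earlier ones by a rule. -}

module Defs where

open import Data.Nat using (ℕ)
open import Data.Product using (_×_)

infixr 8 ¬_ ⌟_
infixl 7 _⊓_ _⊔_

data Formula : Set where
  var : ℕ → Formula
  ¬_  : Formula → Formula
  ⌟_  : Formula → Formula
  _⊓_ : Formula → Formula → Formula
  _⊔_ : Formula → Formula → Formula
  ⊤'  : Formula
  ⊥'  : Formula

_∨_ : Formula → Formula → Formula
φ ∨ ψ = ¬ (¬ φ ⊓ ¬ ψ)

_∧_ : Formula → Formula → Formula
φ ∧ ψ = ⌟ (⌟ φ ⊔ ⌟ ψ)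

infix 4 _⇒_
data _⇒_ : Formula → Formula → Set where
  ax-id      : ∀ {φ} → φ ⇒ φ
  ax-⊓l      : ∀ {φ ψ} → φ ⊓ ψ ⇒ φ
  ax-⊓r      : ∀ {φ ψ} → φ ⊓ ψ ⇒ ψ
  ax-⊔l      : ∀ {φ ψ} → φ ⇒ φ ⊔ ψ
  ax-⊔r      : ∀ {φ ψ} → ψ ⇒ φ ⊔ ψ
  ax-¬⊓      : ∀ {φ} → ¬ (φ ⊓ φ) ⇒ ¬ φ
  ax-⌟⊔      : ∀ {φ} → ⌟ φ ⇒ ⌟ (φ ⊔ φ)
  ax-contr₁  : ∀ {φ} → φ ⊓ ¬ φ ⇒ ⊥'
  ax-contr₂  : ∀ {φ} → ⊥' ⇒ φ ⊓ ¬ φ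
  ax-lem₁    : ∀ {φ} → ⊤' ⇒ φ ⊔ ⌟ φ
  ax-lem₂    : ∀ {φ} → φ ⊔ ⌟ φ ⇒ ⊤'
  ax-¬¬₁     : ∀ {φ ψ} → ¬ ¬ (φ ⊓ ψ) ⇒ φ ⊓ ψ
  ax-¬¬₂     : ∀ {φ ψ} → φ ⊓ ψ ⇒ ¬ ¬ (φ ⊓ ψ)
  ax-⌟⌟₁     : ∀ {φ ψ} → ⌟ ⌟ (φ ⊔ ψ) ⇒ φ ⊔ ψ
  ax-⌟⌟₂     : ∀ {φ ψ} → φ ⊔ ψ ⇒ ⌟ ⌟ (φ ⊔ ψ)
  ax-abs⊓    : ∀ {φ ψ} → φ ⊓ φ ⇒ φ ⊓ (φ ⊔ ψ)
  ax-abs⊔    : ∀ {φ ψ} → φ ⊔ (φ ⊓ ψ) ⇒ φ ⊔ φ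
  ax-dist⊓₁  : ∀ {φ ψ θ} → φ ⊓ (ψ ∨ θ) ⇒ (φ ⊓ ψ) ∨ (φ ⊓ θ)
  ax-dist⊓₂  : ∀ {φ ψ θ} → (φ ⊓ ψ) ∨ (φ ⊓ θ) ⇒ φ ⊓ (ψ ∨ θ)
  ax-dist⊔₁  : ∀ {φ ψ θ} → φ ⊔ (ψ ∧ θ) ⇒ (φ ⊔ ψ) ∧ (φ ⊔ θ)
  ax-dist⊔₂  : ∀ {φ ψ θ} → (φ ⊔ ψ) ∧ (φ ⊔ θ) ⇒ φ ⊔ (ψ ∧ θ)
  ax-sq₁     : ∀ {φ} → (φ ⊔ φ) ⊓ (φ ⊔ φ) ⇒ (φ ⊓ φ) ⊔ (φ ⊓ φ)
  ax-sq₂     : ∀ {φ} → (φ ⊓ φ) ⊔ (φ ⊓ φ) ⇒ (φ ⊔ φ) ⊓ (φ ⊔ φ)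
  cut        : ∀ {φ ψ θ} → φ ⇒ ψ → ψ ⇒ θ → φ ⇒ θ
  mono⊓ʳ     : ∀ {φ ψ θ} → φ ⇒ ψ → φ ⊓ θ ⇒ ψ ⊓ θ
  mono⊓ˡ     : ∀ {φ ψ θ} → φ ⇒ ψ → θ ⊓ φ ⇒ θ ⊓ ψ
  mono⊔ʳ     : ∀ {φ ψ θ} → φ ⇒ ψ → φ ⊔ θ ⇒ ψ ⊔ θ
  mono⊔ˡ     : ∀ {φ ψ θ} → φ ⇒ ψ → θ ⊔ φ ⇒ θ ⊔ ψ
  anti¬      : ∀ {φ ψ} → φ ⇒ ψ → ¬ ψ ⇒ ¬ φ
  anti⌟      : ∀ {φ ψ} → φ ⇒ ψ → ⌟ ψ ⇒ ⌟ φ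
  rule-⊑     : ∀ {φ ψ} → φ ⊓ ψ ⇒ φ ⊓ φ → φ ⊓ φ ⇒ φ ⊓ ψ
               → φ ⊔ ψ ⇒ ψ ⊔ ψ → ψ ⊔ ψ ⇒ φ ⊔ ψ → φ ⇒ ψ

infix 4 _⇔_
_⇔_ : Formula → Formula → Set
φ ⇔ ψ = (φ ⇒ ψ) × (ψ ⇒ φ)

{-# OPTIONS --safe #-}
-- In L, ¬¬ cancels only on ⊓-formulas and ⌟⌟ only on ⊔-formulas, so the
-- antitone rules for ¬ and ⌟ give contraposition exactly there.  Every item is
-- such a contraposition applied to ⊥' ⇒ φ ⊓ ¬ φ ⇒ φ, to φ ⇒ φ ⊔ ⌟ φ ⇒ ⊤', or to
-- a projection or injection; the absorption laws then follow by distributivity.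
module Submission where

open import Defs
open import Data.Product using (_×_; _,_)

⊥'-minimum : ∀ {φ} → ⊥' ⇒ φ
⊥'-minimum {φ} = cut (ax-contr₂ {φ}) ax-⊓l

⊤'-maximum : ∀ {φ} → φ ⇒ ⊤'
⊤'-maximum {φ} = cut ax-⊔l (ax-lem₂ {φ})

⊓⇒¬ : ∀ {φ ψ χ} → χ ⇒ ¬ (φ ⊓ ψ) → φ ⊓ ψ ⇒ ¬ χ
⊓⇒¬ χ⇒¬φ⊓ψ = cut ax-¬¬₂ (anti¬ χ⇒¬φ⊓ψ)

¬⇒⊓ : ∀ {φ ψ χ} → ¬ (φ ⊓ ψ) ⇒ χ → ¬ χ ⇒ φ ⊓ ψ
¬⇒⊓ ¬φ⊓ψ⇒χ = cut (anti¬ ¬φ⊓ψ⇒χ) ax-¬¬₁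

⊔⇒⌟ : ∀ {φ ψ χ} → χ ⇒ ⌟ (φ ⊔ ψ) → φ ⊔ ψ ⇒ ⌟ χ
⊔⇒⌟ χ⇒⌟φ⊔ψ = cut ax-⌟⌟₂ (anti⌟ χ⇒⌟φ⊔ψ)

⌟⇒⊔ : ∀ {φ ψ χ} → ⌟ (φ ⊔ ψ) ⇒ χ → ⌟ χ ⇒ φ ⊔ ψ
⌟⇒⊔ ⌟φ⊔ψ⇒χ = cut (anti⌟ ⌟φ⊔ψ⇒χ) ax-⌟⌟₁

x⊓y⇒x⊓y∨z : ∀ {φ ψ θ} → φ ⊓ ψ ⇒ (φ ⊓ ψ) ∨ θ
x⊓y⇒x⊓y∨z = ⊓⇒¬ ax-⊓l

x⊔y∧z⇒x⊔y : ∀ {φ ψ θ} → (φ ⊔ ψ) ∧ θ ⇒ φ ⊔ ψ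
x⊔y∧z⇒x⊔y = ⌟⇒⊔ ax-⊔l

⊓-absorbs-∨ : ∀ {φ ψ} → φ ⊓ φ ⇒ φ ⊓ (φ ∨ ψ)
⊓-absorbs-∨ = cut x⊓y⇒x⊓y∨z ax-dist⊓₂

⊔-absorbs-∧ : ∀ {φ ψ} → φ ⊔ (φ ∧ ψ) ⇒ φ ⊔ φ
⊔-absorbs-∧ = cut ax-dist⊔₁ x⊔y∧z⇒x⊔y

¬⊤'⇒⊥' : ¬ ⊤' ⇒ ⊥'
¬⊤'⇒⊥' = cut (¬⇒⊓ ⊤'-maximum) (ax-contr₁ {⊥'})

⊤'⇒⌟⊥' : ⊤' ⇒ ⌟ ⊥'
⊤'⇒⌟⊥' = cut (ax-lem₁ {⊤'}) (⊔⇒⌟ ⊥'-minimum)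

¬⊥'⇔⊤'⊓⊤' : ¬ ⊥' ⇔ ⊤' ⊓ ⊤'
¬⊥'⇔⊤'⊓⊤' = ¬⇒⊓ (cut ax-¬⊓ ¬⊤'⇒⊥') , ⊓⇒¬ ⊥'-minimum

⌟⊤'⇔⊥'⊔⊥' : ⌟ ⊤' ⇔ ⊥' ⊔ ⊥'
⌟⊤'⇔⊥'⊔⊥' = ⌟⇒⊔ ⊤'-maximum , ⊔⇒⌟ (cut ⊤'⇒⌟⊥' ax-⌟⊔)

theorem5p5 : ∀ (φ ψ : Formula) →
    (φ ⊓ φ ⇒ φ ⊓ (φ ∨ ψ))
    × (φ ⊔ (φ ∧ ψ) ⇒ φ ⊔ φ)
    × (⊥' ⇒ φ)
    × (φ ⇒ ⊤')
    × (¬ ⊤' ⇒ ⊥')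
    × (⊤' ⇒ ⌟ ⊥')
    × (¬ ⊥' ⇔ ⊤' ⊓ ⊤')
    × (⌟ ⊤' ⇔ ⊥' ⊔ ⊥')
theorem5p5 _ _ =
  ⊓-absorbs-∨ , ⊔-absorbs-∧ , ⊥'-minimum , ⊤'-maximum ,
  ¬⊤'⇒⊥' , ⊤'⇒⌟⊥' , ¬⊥'⇔⊤'⊓⊤' , ⌟⊤'⇔⊥'⊔⊥'
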